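{- Let $a,b\in\mathbb{C}$ with $ab\ne0$, let $f=(0,a,b,1)$, $u=[1,a]$, $u'=[-1/b^2,1]$ and $u_0=[1,-1]$. Then $NAND_2\le^{acyc}_{con}\{f,u,u'\}$ and $OR_2\le^{acyc}_{con}\{f,u,u',u_0\}$.
   Context: Constraint functions are $f:\{0,1\}^k\to\mathbb{C}$; a binary function is written $(f(00),f(01),f(10),f(11))$ and a unary one as $[f(0),f(1)]$; $OR_2=(0,1,1,1)$, $NAND_2=(1,1,1,0)$. A hypergraph is acyclic if repeatedly deleting vertices lying in at most one hyperedge and deleting hyperedges empty or contained in another yields the empty hypergraph. $f\le^{acyc}_{con}\mathcal{G}$ ($f$ of arity $k$ on $x_1,\dots,x_k$) means: there exist $\lambda\ne0$, auxiliary variables $y_1,\dots,y_m$ and finitely many constraints $(g_j,(z^j_1,\dots,z^j_{d_j}))$, $g_j\in\mathcal{G}$, $z^j_\ell\in\{x_1,\dots,x_k,y_1,\dots,y_m\}$, whose hypergraph (vertices $x$'s and $y$'s, hyperedges $\{z^j_1,\dots,z^j_{d_j}\}$) is acyclic, with $f(x)=\lambda\sum_{y\in\{0,1\}^m}\prod_j g_j(z^j_1,\dots,z^j_{d_j})$ for all $x$. -}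

module Defs where

open import Level using (Level; _⊔_) renaming (suc to lsuc)
open import Data.Nat as ℕ using (ℕ; zero; suc; _≤_)
open import Data.Bool using (Bool; true; false)
open import Data.Fin using (Fin; _≟_) renaming (zero to fz; suc to fs)
open import Data.List using (List; []; _∷_; _++_; map; filter; length)
open import Data.List.Membership.Propositional using (_∈_)
open import Data.List.Relation.Unary.Any using (any?)
open import Data.List.Relation.Binary.Subset.Propositional using (_⊆_)
open import Data.Product using (Σ; ∃; _×_; _,_; proj₁)
open import Data.Sum using (_⊎_)
open import Data.Vec.Functional as VF using (Vector)
open import Relation.Nullary using (¬_)
open import Relation.Nullary.Decidable using (¬?)
open import Relation.Binary.PropositionalEquality using (_≡_)
open import Relation.Binary.Construct.Closure.ReflexiveTransitive using (Star)
open import Algebra.Bundles using (CommutativeRing)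

-- Stand-in for ℂ: an algebraically closed field of characteristic 0
-- (the stdlib has no complex numbers).

module RingHelpers {c ℓ} (R : CommutativeRing c ℓ) where
  open CommutativeRing R
  natCast : ℕ → Carrier
  natCast zero = 0#
  natCast (suc n) = 1# + natCast n
  -- Horner evaluation of the monic polynomial
  -- x^(n+1) + cs(n) x^n + ... + cs(0)
  monicEval : (n : ℕ) → (Fin (suc n) → Carrier) → Carrier → Carrier
  monicEval zero cs x = x + cs fz
  monicEval (suc n) cs x = monicEval n (λ i → cs (fs i)) x * x + cs fz

record ComplexLikeField c ℓ : Set (lsuc (c ⊔ ℓ)) where
  field
    commRing : CommutativeRing c ℓ
  open CommutativeRing commRing public hiding (ring)
  open RingHelpers commRing public
  field
    inverse : ∀ x → ¬ (x ≈ 0#) → ∃ λ y → x * y ≈ 1#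
    char0 : ∀ n → ¬ (natCast (suc n) ≈ 0#)
    algClosed : ∀ n (cs : Fin (suc n) → Carrier) → ∃ λ x → monicEval n cs x ≈ 0#

Hypergraph : ℕ → Set
Hypergraph n = List (Fin n) × List (List (Fin n))

data HStep {n : ℕ} : Hypergraph n → Hypergraph n → Set where
  delVertex : ∀ vs₁ v vs₂ es →
    length (filter (λ e → any? (v ≟_) e) es) ≤ 1 →
    HStep (vs₁ ++ v ∷ vs₂ , es)
          (vs₁ ++ vs₂ , map (filter (λ w → ¬? (w ≟ v))) es)
  delEdge : ∀ vs es₁ e es₂ →
    (e ≡ [] ⊎ ∃ λ e′ → e′ ∈ es₁ ++ es₂ × e ⊆ e′) →
    HStep (vs , es₁ ++ e ∷ es₂) (vs , es₁ ++ es₂)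

Acyclic : {n : ℕ} → Hypergraph n → Set
Acyclic H = Star HStep H ([] , [])

module _ {c ℓ} (K : ComplexLikeField c ℓ) where
  open ComplexLikeField K

  record ConstraintFn : Set c where
    constructor mkFn
    field
      arity : ℕ
      fn    : (Fin arity → Bool) → Carrier
  open ConstraintFn public

  binary : Carrier → Carrier → Carrier → Carrier → ConstraintFn
  binary p q r s = mkFn 2 g
    where
      g : (Fin 2 → Bool) → Carrier
      g x with x fz | x (fs fz)
      ... | false | false = p
      ... | false | true  = q
      ... | true  | false = r
      ... | true  | true  = s

  unary : Carrier → Carrier → ConstraintFn
  unary p q = mkFn 1 g
    where
      g : (Fin 1 → Bool) → Carrier
      g x with x fz
      ... | false = p
      ... | true  = q

  OR₂ NAND₂ : ConstraintFn
  OR₂   = binary 0# 1# 1# 1#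
  NAND₂ = binary 1# 1# 1# 0#

  sumAll : (m : ℕ) → ((Fin m → Bool) → Carrier) → Carrier
  sumAll zero h = h (λ ())
  sumAll (suc m) h = sumAll m (λ y → h (VF._∷_ false y)) + sumAll m (λ y → h (VF._∷_ true y))

  prodL : List Carrier → Carrier
  prodL [] = 1#
  prodL (x ∷ xs) = x * prodL xs

  -- a constraint (g, (z₁,…,z_d)) with g ∈ 𝒢, variables among Fin (k+m)
  -- (indices < k are x₁..x_k, the rest are y₁..y_m)
  record Constraint (𝒢 : List ConstraintFn) (N : ℕ) : Set c where
    constructor mkCon
    field
      g    : ConstraintFn
      g∈𝒢  : g ∈ 𝒢
      vars : Fin (arity g) → Fin N
  open Constraint public

  conHypergraph : ∀ {𝒢 N} → List (Constraint 𝒢 N) → Hypergraph N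
  conHypergraph {N = N} cs =
    Data.List.allFin N , map (λ κ → Data.List.tabulate (vars κ)) cs

  conValue : ∀ {𝒢 N} → (Fin N → Bool) → Constraint 𝒢 N → Carrier
  conValue σ κ = fn (g κ) (λ i → σ (vars κ i))

  _≤acyc_ : ConstraintFn → List ConstraintFn → Set (c ⊔ ℓ)
  f ≤acyc 𝒢 =
    Σ Carrier λ λ′ → ¬ (λ′ ≈ 0#) ×
    Σ ℕ λ m → Σ (List (Constraint 𝒢 (arity f ℕ.+ m))) λ cs →
      Acyclic (conHypergraph cs) ×
      (∀ (x : Fin (arity f) → Bool) →
         fn f x ≈ λ′ * sumAll m (λ y → prodL (map (conValue (x VF.++ y)) cs)))

{-# OPTIONS --safe #-}
module Submission where

-- In the NAND gadget an auxiliary y, weighted by u′, is joined by f to x₁ and x₂,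
-- each weighted by u. For y = 1 every xᵢ contributes u(xᵢ) f(xᵢ,1) = a; for y = 0
-- only xᵢ = 1 survives, with weight ab. The sum is therefore a²(1 + b′b² x₁x₂),
-- which is a²·NAND(x₁,x₂) since b′b² = -1. The OR gadget u(x₁)² u′(x₂) u₀(x₂) f(x₁,x₂)²
-- has no auxiliary variable: it is 0 at (0,0) and -a² at the other three points.
-- Both hypergraphs become stars once unary and repeated edges are absorbed into
-- binary ones, and rescaling by a⁻² needs only a ≠ 0.

open import Defs
open import Algebra.Bundles using (CommutativeRing)
import Algebra.Definitions
import Algebra.Properties.Ring
import Algebra.Solver.Ring.NaturalCoefficients.Default as SemiringSolver
open import Data.Bool using (Bool; true; false)
open import Data.Fin using (Fin; zero; suc)
open import Data.List using (List; []; _∷_; _++_; map)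
open import Data.List.Membership.Propositional using (find)
open import Data.List.Membership.Propositional.Properties using (∈-++⁺ʳ)
open import Data.List.Relation.Binary.Subset.Propositional using (_⊆_)
open import Data.List.Relation.Binary.Subset.Propositional.Properties
  using (⊆-refl; xs⊆xs++ys; xs⊆ys++xs)
open import Data.List.Relation.Unary.All using (All; []; _∷_)
open import Data.List.Relation.Unary.Any using (Any; here; there)
open import Data.Nat as ℕ using (z≤n; s≤s)
open import Data.Product using (_×_; _,_)
open import Data.Sum using (inj₁; inj₂)
import Data.Vec.Functional as Vector
open import Function using (const)
open import Relation.Binary.Construct.Closure.ReflexiveTransitive using (Star; ε; _◅_; _◅◅_)
import Relation.Binary.PropositionalEquality as ≡
import Relation.Binary.Reasoning.Setoid
open import Relation.Nullary using (¬_)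

delSubedges : ∀ {n} (vs : List (Fin n)) (ds es : List (List (Fin n))) →
              All (λ d → Any (d ⊆_) es) ds →
              Star HStep (vs , ds ++ es) (vs , es)
delSubedges vs []       es []                 = ε
delSubedges vs (d ∷ ds) es (d⊆some-e ∷ ds⊆es) =
  let e , e∈es , d⊆e = find d⊆some-e in
  delEdge vs [] d (ds ++ es) (inj₂ (e , ∈-++⁺ʳ ds e∈es , d⊆e)) ◅ delSubedges vs ds es ds⊆es

delEmptyEdge : ∀ {n} (vs : List (Fin n)) → HStep (vs , [] ∷ []) (vs , [])
delEmptyEdge vs = delEdge vs [] [] [] (inj₁ ≡.refl)

⟨_,_⟩ : ∀ {n} → Fin n → Fin n → Fin 2 → Fin n
⟨ v , w ⟩ zero    = v
⟨ v , w ⟩ (suc _) = w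

module _ {c ℓ} (K : ComplexLikeField c ℓ) where
  open ComplexLikeField K hiding (zero)
  open Algebra.Definitions _≈_ using (LeftInvertible)
  open Algebra.Properties.Ring (CommutativeRing.ring commRing) using (-1*x≈-x; -‿involutive)
  open SemiringSolver commutativeSemiring using (solve; _:=_; _:+_; _:*_; con)
  open Relation.Binary.Reasoning.Setoid setoid

  1#≉0# : ¬ 1# ≈ 0#
  1#≉0# 1≈0 = char0 0 (trans (+-identityʳ 1#) 1≈0)

  x*y≈1⇒x≉0 : ∀ {x y} → x * y ≈ 1# → ¬ x ≈ 0#
  x*y≈1⇒x≉0 {x} {y} xy≈1 x≈0 = 1#≉0# (begin
    1#     ≈⟨ xy≈1 ⟨
    x * y  ≈⟨ *-congʳ x≈0 ⟩
    0# * y ≈⟨ zeroˡ y ⟩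
    0#     ∎)

  x*y≉0⇒x≉0 : ∀ {x y} → ¬ x * y ≈ 0# → ¬ x ≈ 0#
  x*y≉0⇒x≉0 {x} {y} xy≉0 x≈0 = xy≉0 (trans (*-congʳ x≈0) (zeroˡ y))

  ≉0⇒leftInvertible : ∀ {x} → ¬ x ≈ 0# → LeftInvertible 1# _*_ x
  ≉0⇒leftInvertible {x} x≉0 = let y , xy≈1 = inverse x x≉0 in y , trans (*-comm y x) xy≈1

  *-leftInvertible : ∀ {x y} → LeftInvertible 1# _*_ x → LeftInvertible 1# _*_ y →
                     LeftInvertible 1# _*_ (x * y)
  *-leftInvertible {x} {y} (x⁻¹ , x⁻¹x≈1) (y⁻¹ , y⁻¹y≈1) = x⁻¹ * y⁻¹ , (begin
    x⁻¹ * y⁻¹ * (x * y)   ≈⟨ solve 4 (λ x y x⁻¹ y⁻¹ → x⁻¹ :* y⁻¹ :* (x :* y) := x⁻¹ :* x :* (y⁻¹ :* y)) refl x y x⁻¹ y⁻¹ ⟩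
    x⁻¹ * x * (y⁻¹ * y)   ≈⟨ *-cong x⁻¹x≈1 y⁻¹y≈1 ⟩
    1# * 1#               ≈⟨ *-identityˡ 1# ⟩
    1#                    ∎)

  -1#-leftInvertible : LeftInvertible 1# _*_ (- 1#)
  -1#-leftInvertible = - 1# , trans (-1*x≈-x (- 1#)) (-‿involutive 1#)

  gadgetValue : ∀ {𝒢 k} m → List (Constraint K 𝒢 (k ℕ.+ m)) → (Fin k → Bool) → Carrier
  gadgetValue m cs x = sumAll K m (λ y → prodL K (map (conValue K (x Vector.++ y)) cs))

  ≤acyc-fromScaledGadget : ∀ {f 𝒢 s} m (cs : List (Constraint K 𝒢 (arity f ℕ.+ m))) →
    LeftInvertible 1# _*_ s → Acyclic (conHypergraph K cs) →
    (∀ x → gadgetValue m cs x ≈ s * fn f x) → _≤acyc_ K f 𝒢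
  ≤acyc-fromScaledGadget {f} {s = s} m cs (s⁻¹ , s⁻¹s≈1) acyclic cs≈s*f =
    s⁻¹ , x*y≈1⇒x≉0 s⁻¹s≈1 , m , cs , acyclic , λ x → begin
      fn f x                   ≈⟨ *-identityˡ (fn f x) ⟨
      1# * fn f x              ≈⟨ *-congʳ s⁻¹s≈1 ⟨
      s⁻¹ * s * fn f x         ≈⟨ *-assoc s⁻¹ s (fn f x) ⟩
      s⁻¹ * (s * fn f x)       ≈⟨ *-congˡ (cs≈s*f x) ⟨
      s⁻¹ * gadgetValue m cs x ∎

  module _ (a b b′ : Carrier) where

    f u u′ u₀ : ConstraintFn K
    f  = binary K 0# a b 1#
    u  = unary K 1# a
    u′ = unary K b′ 1#
    u₀ = unary K 1# (- 1#)

    𝒢 𝒢₀ : List (ConstraintFn K)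
    𝒢  = f ∷ u ∷ u′ ∷ []
    𝒢₀ = f ∷ u ∷ u′ ∷ u₀ ∷ []

    module NANDGadget where
      x₁ x₂ y : Fin 3
      x₁ = zero
      x₂ = suc zero
      y  = suc (suc zero)

      constraints : List (Constraint K 𝒢 3)
      constraints = mkCon u′ (there (there (here ≡.refl))) (const y)
                  ∷ mkCon u (there (here ≡.refl)) (const x₁)
                  ∷ mkCon u (there (here ≡.refl)) (const x₂)
                  ∷ mkCon f (here ≡.refl) ⟨ x₁ , y ⟩
                  ∷ mkCon f (here ≡.refl) ⟨ x₂ , y ⟩
                  ∷ []

      acyclic : Acyclic (conHypergraph K constraints)
      acyclic =
            delSubedges (x₁ ∷ x₂ ∷ y ∷ [])
              ((y ∷ []) ∷ (x₁ ∷ []) ∷ (x₂ ∷ []) ∷ [])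
              ((x₁ ∷ y ∷ []) ∷ (x₂ ∷ y ∷ []) ∷ [])
              (  here (xs⊆ys++xs (y ∷ []) (x₁ ∷ []))
               ∷ here (xs⊆xs++ys (x₁ ∷ []) (y ∷ []))
               ∷ there (here (xs⊆xs++ys (x₂ ∷ []) (y ∷ [])))
               ∷ [])
        ◅◅ delVertex [] x₁ (x₂ ∷ y ∷ []) _ (s≤s z≤n)
        ◅  delVertex [] x₂ (y ∷ []) _ (s≤s z≤n)
        ◅  delSubedges (y ∷ []) ((y ∷ []) ∷ []) ((y ∷ []) ∷ []) (here ⊆-refl ∷ [])
        ◅◅ delVertex [] y [] _ (s≤s z≤n)
        ◅  delEmptyEdge []
        ◅  ε

      -- Each summand (one per value of y) is the product of the constraint values in
      -- list order, closed by the 1# of prodL; the solver terms mirror that shape.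
      value : b′ * (b * b) ≈ - 1# → ∀ x → gadgetValue 1 constraints x ≈ a * a * fn (NAND₂ K) x
      value b′b²≈-1 x with x zero | x (suc zero)
      ... | false | false =
        solve 2 (λ a b′ → b′ :* (con 1 :* (con 1 :* (con 0 :* (con 0 :* con 1))))
                          :+ con 1 :* (con 1 :* (con 1 :* (a :* (a :* con 1))))
                          := a :* a :* con 1) refl a b′
      ... | false | true  =
        solve 3 (λ a b b′ → b′ :* (con 1 :* (a :* (con 0 :* (b :* con 1))))
                            :+ con 1 :* (con 1 :* (a :* (a :* (con 1 :* con 1))))
                            := a :* a :* con 1) refl a b b′
      ... | true  | false =
        solve 3 (λ a b b′ → b′ :* (a :* (con 1 :* (b :* (con 0 :* con 1))))
                            :+ con 1 :* (a :* (con 1 :* (con 1 :* (a :* con 1))))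
                            := a :* a :* con 1) refl a b b′
      ... | true  | true  = begin
        b′ * (a * (a * (b * (b * 1#)))) + 1# * (a * (a * (1# * (1# * 1#))))
          ≈⟨ solve 3 (λ a b b′ → b′ :* (a :* (a :* (b :* (b :* con 1))))
                                 :+ con 1 :* (a :* (a :* (con 1 :* (con 1 :* con 1))))
                                 := a :* a :* (b′ :* (b :* b) :+ con 1)) refl a b b′ ⟩
        a * a * (b′ * (b * b) + 1#) ≈⟨ *-congˡ (+-congʳ b′b²≈-1) ⟩
        a * a * (- 1# + 1#)         ≈⟨ *-congˡ (-‿inverseˡ 1#) ⟩
        a * a * 0#                  ∎

    module ORGadget where
      x₁ x₂ : Fin 2
      x₁ = zero
      x₂ = suc zero

      constraints : List (Constraint K 𝒢₀ 2)
      constraints = mkCon u (there (here ≡.refl)) (const x₁)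
                  ∷ mkCon u (there (here ≡.refl)) (const x₁)
                  ∷ mkCon u′ (there (there (here ≡.refl))) (const x₂)
                  ∷ mkCon u₀ (there (there (there (here ≡.refl)))) (const x₂)
                  ∷ mkCon f (here ≡.refl) ⟨ x₁ , x₂ ⟩
                  ∷ mkCon f (here ≡.refl) ⟨ x₁ , x₂ ⟩
                  ∷ []

      acyclic : Acyclic (conHypergraph K constraints)
      acyclic =
            delSubedges (x₁ ∷ x₂ ∷ [])
              ((x₁ ∷ []) ∷ (x₁ ∷ []) ∷ (x₂ ∷ []) ∷ (x₂ ∷ []) ∷ (x₁ ∷ x₂ ∷ []) ∷ [])
              ((x₁ ∷ x₂ ∷ []) ∷ [])
              (  here (xs⊆xs++ys (x₁ ∷ []) (x₂ ∷ []))
               ∷ here (xs⊆xs++ys (x₁ ∷ []) (x₂ ∷ []))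
               ∷ here (xs⊆ys++xs (x₂ ∷ []) (x₁ ∷ []))
               ∷ here (xs⊆ys++xs (x₂ ∷ []) (x₁ ∷ []))
               ∷ here ⊆-refl
               ∷ [])
        ◅◅ delVertex [] x₁ (x₂ ∷ []) _ (s≤s z≤n)
        ◅  delVertex [] x₂ [] _ (s≤s z≤n)
        ◅  delEmptyEdge []
        ◅  ε

      value : b′ * (b * b) ≈ - 1# → ∀ x → gadgetValue 0 constraints x ≈ a * a * - 1# * fn (OR₂ K) x
      value b′b²≈-1 x with x zero | x (suc zero)
      ... | false | false =
        solve 3 (λ a b′ m → con 1 :* (con 1 :* (b′ :* (con 1 :* (con 0 :* (con 0 :* con 1)))))
                            := a :* a :* m :* con 0) refl a b′ (- 1#)
      ... | false | true  =
        solve 2 (λ a m → con 1 :* (con 1 :* (con 1 :* (m :* (a :* (a :* con 1)))))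
                         := a :* a :* m :* con 1) refl a (- 1#)
      ... | true  | false = begin
        a * (a * (b′ * (1# * (b * (b * 1#)))))
          ≈⟨ solve 3 (λ a b b′ → a :* (a :* (b′ :* (con 1 :* (b :* (b :* con 1)))))
                                 := a :* a :* (b′ :* (b :* b)) :* con 1) refl a b b′ ⟩
        a * a * (b′ * (b * b)) * 1# ≈⟨ *-congʳ (*-congˡ b′b²≈-1) ⟩
        a * a * - 1# * 1#           ∎
      ... | true  | true  =
        solve 2 (λ a m → a :* (a :* (con 1 :* (m :* (con 1 :* (con 1 :* con 1)))))
                         := a :* a :* m :* con 1) refl a (- 1#)

lemma3p8 : ∀ {c ℓ} (K : ComplexLikeField c ℓ) →
    let open ComplexLikeField K in
    ∀ (a b b′ : Carrier) → ¬ (a * b ≈ 0#) →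
    -- b′ = -1/b² (given via b′ · b² = -1)
    b′ * (b * b) ≈ - 1# →
    _≤acyc_ K (NAND₂ K) (binary K 0# a b 1# ∷ unary K 1# a ∷ unary K b′ 1# ∷ [])
    × _≤acyc_ K (OR₂ K) (binary K 0# a b 1# ∷ unary K 1# a ∷ unary K b′ 1# ∷ unary K 1# (- 1#) ∷ [])
lemma3p8 K a b b′ ab≉0 b′b²≈-1 =
    ≤acyc-fromScaledGadget K 1 NAND.constraints a²-invertible NAND.acyclic (NAND.value b′b²≈-1)
  , ≤acyc-fromScaledGadget K 0 OR.constraints (*-leftInvertible K a²-invertible (-1#-leftInvertible K))
                           OR.acyclic (OR.value b′b²≈-1)
  where
    module NAND = NANDGadget K a b b′
    module OR = ORGadget K a b b′
    open ComplexLikeField K using (_≈_; _*_; 1#)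
    open Algebra.Definitions _≈_ using (LeftInvertible)

    a-invertible : LeftInvertible 1# _*_ a
    a-invertible = ≉0⇒leftInvertible K (x*y≉0⇒x≉0 K ab≉0)

    a²-invertible : LeftInvertible 1# _*_ (a * a)
    a²-invertible = *-leftInvertible K a-invertible a-invertible
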